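{- Every dense immune set $S\subseteq\omega$ has intrinsic density $0$.
   Context: The principal function of an infinite set $A$ is $p_A(n)=\mu x\,[\,|A\cap[0,x)|\ge n\,]$. An infinite set $A$ is dense immune if for every computable $f$, $p_A(n)\ge f(n)$ for all sufficiently large $n$. For $X\subseteq\omega$, $\rho_n(X)=|X\cap[0,n)|/n$; $X$ has intrinsic density $0$ if $\lim_n\rho_n(\pi(X))=0$ for every computable permutation $\pi$ of $\omega$. -}

module Defs where

open import Data.Nat using (ℕ; zero; suc; _+_; _≤_; _<_; NonZero)
open import Data.Fin using (Fin)
open import Data.Vec using (Vec; []; _∷_; lookup)
open import Data.Bool using (Bool; true; false)
open import Data.Product using (Σ; ∃; _×_; _,_)
open import Data.Integer using (+_)
open import Data.Rational using (ℚ; 0ℚ; _/_) renaming (_<_ to _<ℚ_)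
open import Relation.Binary.PropositionalEquality using (_≡_)
open import Function.Bundles using (_↔_; Inverse)

data Code : ℕ → Set where
  zer  : ∀ {k} → Code k
  succ : Code 1
  proj : ∀ {k} → Fin k → Code k
  comp : ∀ {m k} → Code m → Vec (Code k) m → Code k
  prec : ∀ {k} → Code k → Code (suc (suc k)) → Code (suc k)
  mu   : ∀ {k} → Code (suc k) → Code k

mutual
  data Eval : ∀ {k} → Code k → Vec ℕ k → ℕ → Set where
    ev-zer  : ∀ {k} {xs : Vec ℕ k} → Eval zer xs 0
    ev-succ : ∀ {x} → Eval succ (x ∷ []) (suc x)
    ev-proj : ∀ {k} {i : Fin k} {xs : Vec ℕ k} → Eval (proj i) xs (lookup xs i)
    ev-comp : ∀ {m k} {f : Code m} {gs : Vec (Code k) m} {xs : Vec ℕ k}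
                {ys : Vec ℕ m} {y : ℕ} →
              EvalAll gs xs ys → Eval f ys y → Eval (comp f gs) xs y
    ev-prec-zero : ∀ {k} {g : Code k} {h : Code (suc (suc k))} {xs : Vec ℕ k} {y} →
              Eval g xs y → Eval (prec g h) (zero ∷ xs) y
    ev-prec-suc : ∀ {k} {g : Code k} {h : Code (suc (suc k))} {xs : Vec ℕ k} {n r y} →
              Eval (prec g h) (n ∷ xs) r → Eval h (n ∷ r ∷ xs) y →
              Eval (prec g h) (suc n ∷ xs) y
    ev-mu   : ∀ {k} {f : Code (suc k)} {xs : Vec ℕ k} {y} →
              Eval f (y ∷ xs) 0 →
              (∀ z → z < y → ∃ λ v → Eval f (z ∷ xs) (suc v)) →
              Eval (mu f) xs y

  data EvalAll : ∀ {m k} → Vec (Code k) m → Vec ℕ k → Vec ℕ m → Set where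
    all-[] : ∀ {k} {xs : Vec ℕ k} → EvalAll [] xs []
    all-∷  : ∀ {m k} {g : Code k} {gs : Vec (Code k) m} {xs : Vec ℕ k} {y ys} →
             Eval g xs y → EvalAll gs xs ys → EvalAll (g ∷ gs) xs (y ∷ ys)

Computable : (ℕ → ℕ) → Set
Computable f = ∃ λ (e : Code 1) → ∀ n → Eval e (n ∷ []) (f n)

-- Subsets of ω are given by characteristic functions.

count : (ℕ → Bool) → ℕ → ℕ
count A zero    = zero
count A (suc n) with A n
... | true  = suc (count A n)
... | false = count A n

Infinite : (ℕ → Bool) → Set
Infinite A = ∀ m → ∃ λ n → m ≤ n × A n ≡ true

-- IsPrincipal A n x : x = μx [ |A ∩ [0,x)| ≥ n ], i.e. x = p_A(n)
IsPrincipal : (ℕ → Bool) → ℕ → ℕ → Set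
IsPrincipal A n x = (n ≤ count A x) × (∀ y → y < x → count A y < n)

DenseImmune : (ℕ → Bool) → Set
DenseImmune A =
  Infinite A ×
  (∀ (f : ℕ → ℕ) → Computable f →
     ∃ λ N → ∀ n → N ≤ n → ∀ x → IsPrincipal A n x → f n ≤ x)

-- ρ_n(X) = |X ∩ [0,n)| / n   (ρ_0 := 0 by convention; irrelevant for limits)
ρ : (ℕ → Bool) → ℕ → ℚ
ρ X zero    = 0ℚ
ρ X (suc n) = (+ count X (suc n)) / suc n

LimZero : (ℕ → ℚ) → Set
LimZero g = ∀ (ε : ℚ) → 0ℚ <ℚ ε → ∃ λ N → ∀ n → N ≤ n → g n <ℚ ε

image : (ℕ ↔ ℕ) → (ℕ → Bool) → (ℕ → Bool)
image π X y = X (Inverse.from π y)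

IntrinsicDensityZero : (ℕ → Bool) → Set
IntrinsicDensityZero X =
  ∀ (π : ℕ ↔ ℕ) → Computable (Inverse.to π) → LimZero (ρ (image π X))

-- Let S be dense immune, π a computable permutation, X = π(S), and fix a
-- denominator q.  Put m = 2q and let B(M) = Σ_{y<M} (1 + π⁻¹(y)), so that
-- π⁻¹ maps [0,M) into [0,B(M)).  Since π⁻¹ is computable (by μ-search for
-- π), so is f(j) = 1 + B(j·m); dense immunity gives p_S(j) ≥ f(j) > B(j·m)
-- for large j, hence |S ∩ [0,B(j·m))| < j and, as π⁻¹ is injective,
-- |X ∩ [0,j·m)| < j.  Filling the gaps between multiples of m yields
-- |X ∩ [0,L)|·q < L for large L, i.e. ρ_L(X) < 1/q, which suffices.

module Submission where

open import Defs
open import Data.Nat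
open import Data.Nat.Properties
open import Data.Nat.Coprimality using (Coprime)
open import Data.Nat.DivMod using (_/_; m≡m%n+[m/n]*n; m%n<n; m/n*n≤m; m*n/n≡m; /-monoˡ-≤)
open import Data.Bool using (Bool; true; false)
open import Data.Fin using (zero; suc)
open import Data.Vec using ([]; _∷_)
open import Data.Product using (∃; _×_; _,_)
open import Data.Sum using (inj₁; inj₂)
open import Data.Empty using (⊥-elim)
import Data.Integer as ℤ
import Data.Integer.Properties as ℤ
open import Data.Rational as ℚ using (mkℚ)
import Data.Rational.Properties as ℚ
import Data.Rational.Unnormalised as ℚᵘ
import Data.Rational.Unnormalised.Properties as ℚᵘ
open import Function using (_∘_)
open import Function.Bundles using (_↔_; Inverse; Injection)
open import Function.Properties.Inverse using (↔-sym; ↔⇒↣)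
open import Relation.Binary.PropositionalEquality
open import Relation.Nullary using (yes; no)

comp₁ : ∀ {k} → Code 1 → Code k → Code k
comp₁ f g = comp f (g ∷ [])

comp₂ : ∀ {k} → Code 2 → Code k → Code k → Code k
comp₂ f g h = comp f (g ∷ h ∷ [])

eval-comp₁ : ∀ {k} {f : Code 1} {g : Code k} {xs y z} →
             Eval g xs y → Eval f (y ∷ []) z → Eval (comp₁ f g) xs z
eval-comp₁ g↓ f↓ = ev-comp (all-∷ g↓ all-[]) f↓

eval-comp₂ : ∀ {k} {f : Code 2} {g h : Code k} {xs y y′ z} →
             Eval g xs y → Eval h xs y′ → Eval f (y ∷ y′ ∷ []) z →
             Eval (comp₂ f g h) xs z
eval-comp₂ g↓ h↓ f↓ = ev-comp (all-∷ g↓ (all-∷ h↓ all-[])) f↓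

x₀ : ∀ {k} → Code (suc k)
x₀ = proj zero

x₁ : ∀ {k} → Code (suc (suc k))
x₁ = proj (suc zero)

computable-∘ : ∀ {f g : ℕ → ℕ} → Computable f → Computable g → Computable (f ∘ g)
computable-∘ (e , e↓) (e′ , e′↓) = comp₁ e e′ , λ n → eval-comp₁ (e′↓ n) (e↓ _)

computable-suc : Computable suc
computable-suc = succ , λ n → ev-succ

plus : Code 2
plus = prec x₀ (comp₁ succ x₁)

eval-plus : ∀ a b → Eval plus (a ∷ b ∷ []) (a + b)
eval-plus zero    b = ev-prec-zero ev-proj
eval-plus (suc a) b = ev-prec-suc (eval-plus a b) (eval-comp₁ ev-proj ev-succ)

predecessor : Code 1
predecessor = prec zer x₀

eval-predecessor : ∀ a → Eval predecessor (a ∷ []) (pred a)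
eval-predecessor zero    = ev-prec-zero ev-zer
eval-predecessor (suc a) = ev-prec-suc (eval-predecessor a) ev-proj

monus : Code 2
monus = prec x₀ (comp₁ predecessor x₁)

eval-monus : ∀ b a → Eval monus (b ∷ a ∷ []) (a ∸ b)
eval-monus zero    a = ev-prec-zero ev-proj
eval-monus (suc b) a = ev-prec-suc (eval-monus b a)
  (eval-comp₁ ev-proj (subst (Eval predecessor _) (pred[m∸n]≡m∸[1+n] a b)
                             (eval-predecessor (a ∸ b))))

∣m-n∣≡[m∸n]+[n∸m] : ∀ m n → ∣ m - n ∣ ≡ (m ∸ n) + (n ∸ m)
∣m-n∣≡[m∸n]+[n∸m] zero    n       = cong (_+ n) (sym (0∸n≡0 n))
∣m-n∣≡[m∸n]+[n∸m] (suc m) zero    = sym (+-identityʳ (suc m))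
∣m-n∣≡[m∸n]+[n∸m] (suc m) (suc n) = ∣m-n∣≡[m∸n]+[n∸m] m n

distance : Code 2
distance = comp₂ plus (comp₂ monus x₁ x₀) (comp₂ monus x₀ x₁)

eval-distance : ∀ a b → Eval distance (a ∷ b ∷ []) ∣ a - b ∣
eval-distance a b = subst (Eval distance _) (sym (∣m-n∣≡[m∸n]+[n∸m] a b))
  (eval-comp₂ (eval-comp₂ ev-proj ev-proj (eval-monus b a))
              (eval-comp₂ ev-proj ev-proj (eval-monus a b)) (eval-plus _ _))

plusConst : ℕ → Code 1
plusConst zero    = x₀
plusConst (suc m) = comp₁ succ (plusConst m)

eval-plusConst : ∀ m n → Eval (plusConst m) (n ∷ []) (m + n)
eval-plusConst zero    n = ev-proj
eval-plusConst (suc m) n = eval-comp₁ (eval-plusConst m n) ev-succ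

computable-*const : ∀ m → Computable (_* m)
computable-*const m = prec zer (comp₁ (plusConst m) x₁) , eval
  where
  eval : ∀ j → Eval (prec zer (comp₁ (plusConst m) x₁)) (j ∷ []) (j * m)
  eval zero    = ev-prec-zero ev-zer
  eval (suc j) = ev-prec-suc (eval j) (eval-comp₁ ev-proj (eval-plusConst m (j * m)))

-- Unbounded search needs nonzero values written as successors.
nonzero⇒suc : ∀ {n} → n ≢ 0 → ∃ λ v → n ≡ suc v
nonzero⇒suc {zero}  n≢0 = ⊥-elim (n≢0 refl)
nonzero⇒suc {suc v} n≢0 = v , refl

-- The inverse of a computable permutation is computable: π⁻¹(y) is the
-- least x with ∣ π(x) - y ∣ = 0, found by unbounded search.
inverse-computable : (π : ℕ ↔ ℕ) → Computable (Inverse.to π) → Computable (Inverse.from π)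
inverse-computable π (e , e↓) = mu test , λ y → ev-mu (found y) (earlier y)
  where
  open Inverse π
  test : Code 2
  test = comp₂ distance (comp₁ e x₀) x₁

  eval-test : ∀ x y → Eval test (x ∷ y ∷ []) ∣ to x - y ∣
  eval-test x y = eval-comp₂ (eval-comp₁ ev-proj (e↓ x)) ev-proj (eval-distance _ _)

  found : ∀ y → Eval test (from y ∷ y ∷ []) 0
  found y = subst (Eval test _) (m≡n⇒∣m-n∣≡0 (strictlyInverseˡ y)) (eval-test (from y) y)

  earlier : ∀ y x → x < from y → ∃ λ v → Eval test (x ∷ y ∷ []) (suc v)
  earlier y x x<from with nonzero⇒suc (to-differs ∘ ∣m-n∣≡0⇒m≡n)
    where
    to-differs : to x ≢ y
    to-differs eq = <-irrefl (trans (sym (strictlyInverseʳ x)) (cong from eq)) x<from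
  ... | v , eq = v , subst (Eval test _) eq (eval-test x y)

bound : (ℕ → ℕ) → ℕ → ℕ
bound h zero    = zero
bound h (suc M) = bound h M + suc (h M)

bound-strict : ∀ h M y → y < M → h y < bound h M
bound-strict h (suc M) y y<1+M with m≤n⇒m<n∨m≡n (≤-pred y<1+M)
... | inj₁ y<M  = ≤-trans (bound-strict h M y y<M) (m≤m+n (bound h M) _)
... | inj₂ refl = m≤n+m (suc (h y)) (bound h y)

bound-computable : ∀ {h} → Computable h → Computable (bound h)
bound-computable {h} (e , e↓) = prec zer step , eval
  where
  step : Code 2
  step = comp₂ plus x₁ (comp₁ succ (comp₁ e x₀))

  eval : ∀ M → Eval (prec zer step) (M ∷ []) (bound h M)
  eval zero    = ev-prec-zero ev-zer
  eval (suc M) = ev-prec-suc (eval M)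
    (eval-comp₂ ev-proj (eval-comp₁ (eval-comp₁ ev-proj (e↓ M)) ev-succ) (eval-plus _ _))

bit : Bool → ℕ
bit true  = 1
bit false = 0

count-suc : ∀ A n → count A (suc n) ≡ count A n + bit (A n)
count-suc A n with A n
... | true  = sym (+-comm (count A n) 1)
... | false = sym (+-identityʳ _)

count-mono : ∀ A {x y} → x ≤ y → count A x ≤ count A y
count-mono A {y = zero}  z≤n   = ≤-refl
count-mono A {y = suc y} x≤1+y with m≤n⇒m<n∨m≡n x≤1+y
... | inj₂ refl = ≤-refl
... | inj₁ x<1+y = ≤-trans (count-mono A (≤-pred x<1+y))
                           (subst (count A y ≤_) (sym (count-suc A y)) (m≤m+n _ _))

count-ext : ∀ A B M → (∀ x → x < M → A x ≡ B x) → count A M ≡ count B M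
count-ext A B zero    A≗B = refl
count-ext A B (suc M) A≗B = begin
  count A (suc M)        ≡⟨ count-suc A M ⟩
  count A M + bit (A M)  ≡⟨ cong₂ (λ c b → c + bit b)
                                  (count-ext A B M (λ x x<M → A≗B x (m<n⇒m<1+n x<M)))
                                  (A≗B M ≤-refl) ⟩
  count B M + bit (B M)  ≡⟨ count-suc B M ⟨
  count B (suc M)        ∎
  where open ≡-Reasoning

-- T with the point a removed; used to count along an injection point by point.
remove : ℕ → (ℕ → Bool) → (ℕ → Bool)
remove a T x with x ≟ a
... | yes _ = false
... | no  _ = T x

remove-other : ∀ a T x → x ≢ a → remove a T x ≡ T x
remove-other a T x x≢a with x ≟ a
... | yes x≡a = ⊥-elim (x≢a x≡a)
... | no  _   = refl

remove-self : ∀ a T → remove a T a ≡ false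
remove-self a T with a ≟ a
... | yes _   = refl
... | no  a≢a = ⊥-elim (a≢a refl)

count-remove : ∀ T a B → a < B → count T B ≡ count (remove a T) B + bit (T a)
count-remove T a (suc B) a<1+B with m≤n⇒m<n∨m≡n (≤-pred a<1+B)
... | inj₁ a<B = begin
  count T (suc B)                                  ≡⟨ count-suc T B ⟩
  count T B + bit (T B)                            ≡⟨ cong (_+ bit (T B)) (count-remove T a B a<B) ⟩
  count (remove a T) B + bit (T a) + bit (T B)     ≡⟨ +-assoc (count (remove a T) B) _ _ ⟩
  count (remove a T) B + (bit (T a) + bit (T B))   ≡⟨ cong (count (remove a T) B +_) (+-comm (bit (T a)) _) ⟩
  count (remove a T) B + (bit (T B) + bit (T a))   ≡⟨ +-assoc (count (remove a T) B) _ _ ⟨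
  count (remove a T) B + bit (T B) + bit (T a)     ≡⟨ cong (λ b → count (remove a T) B + bit b + bit (T a))
                                                           (remove-other a T B (>⇒≢ a<B)) ⟨
  count (remove a T) B + bit (remove a T B) + bit (T a) ≡⟨ cong (_+ bit (T a)) (count-suc (remove a T) B) ⟨
  count (remove a T) (suc B) + bit (T a)           ∎
  where open ≡-Reasoning
... | inj₂ refl = begin
  count T (suc a)                                  ≡⟨ count-suc T a ⟩
  count T a + bit (T a)                            ≡⟨ cong (_+ bit (T a)) (count-ext T (remove a T) a
                                                        (λ x x<a → sym (remove-other a T x (<⇒≢ x<a)))) ⟩
  count (remove a T) a + bit (T a)                 ≡⟨ cong (_+ bit (T a)) (+-identityʳ _) ⟨
  count (remove a T) a + bit false + bit (T a)     ≡⟨ cong (λ b → count (remove a T) a + bit b + bit (T a))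
                                                           (remove-self a T) ⟨
  count (remove a T) a + bit (remove a T a) + bit (T a) ≡⟨ cong (_+ bit (T a)) (count-suc (remove a T) a) ⟨
  count (remove a T) (suc a) + bit (T a)           ∎
  where open ≡-Reasoning

count-injection : ∀ (σ : ℕ → ℕ) → (∀ {x y} → σ x ≡ σ y → x ≡ y) →
                  ∀ B M T → (∀ y → y < M → σ y < B) → count (T ∘ σ) M ≤ count T B
count-injection σ σ-inj B zero    T σ<B = z≤n
count-injection σ σ-inj B (suc M) T σ<B = begin
  count (T ∘ σ) (suc M)                        ≡⟨ count-suc (T ∘ σ) M ⟩
  count (T ∘ σ) M + bit (T (σ M))              ≡⟨ cong (_+ bit (T (σ M))) (count-ext _ _ M σM-unused) ⟩
  count (remove (σ M) T ∘ σ) M + bit (T (σ M)) ≤⟨ +-monoˡ-≤ _ (count-injection σ σ-inj B M (remove (σ M) T)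
                                                      (λ y y<M → σ<B y (m<n⇒m<1+n y<M))) ⟩
  count (remove (σ M) T) B + bit (T (σ M))     ≡⟨ count-remove T (σ M) B (σ<B M ≤-refl) ⟨
  count T B                                    ∎
  where
  open ≤-Reasoning
  σM-unused : ∀ x → x < M → T (σ x) ≡ remove (σ M) T (σ x)
  σM-unused x x<M = sym (remove-other (σ M) T (σ x) (<⇒≢ x<M ∘ σ-inj))

principal-below : ∀ A j G → j ≤ count A G → ∃ λ x → x ≤ G × IsPrincipal A j x
principal-below A j zero    j≤0 = 0 , z≤n , j≤0 , λ y ()
principal-below A j (suc G) j≤c with j ≤? count A G
... | yes j≤cG = let x , x≤G , principal = principal-below A j G j≤cG
                 in x , m≤n⇒m≤1+n x≤G , principal
... | no  j≰cG = suc G , ≤-refl , j≤c ,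
                 λ y y<1+G → ≤-<-trans (count-mono A (≤-pred y<1+G)) (≰⇒> j≰cG)

principal-above⇒count-below : ∀ A j G → (∀ x → IsPrincipal A j x → G < x) → count A G < j
principal-above⇒count-below A j G p>G with j ≤? count A G
... | no  j≰c = ≰⇒> j≰c
... | yes j≤c = let x , x≤G , principal = principal-below A j G j≤c
                in ⊥-elim (<⇒≱ (p>G x principal) x≤G)

sparse-blocks⇒sparse : ∀ X d N → let q = suc d; m = q + q in
  (∀ j → N ≤ j → count X (j * m) < j) → ∀ L → suc (N * m) ≤ L → count X L * q < L
sparse-blocks⇒sparse X d N blocks L N·m<L =
  ≤-<-trans (*-monoˡ-≤ q count≤k) k·q<L
  where
  q = suc d
  m = q + q
  k = L / m
  N≤k : N ≤ k
  N≤k = subst (_≤ k) (m*n/n≡m N m) (/-monoˡ-≤ m (<⇒≤ N·m<L))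
  L<[1+k]·m : L < suc k * m
  L<[1+k]·m = subst (_< suc k * m) (sym (m≡m%n+[m/n]*n L m)) (+-monoˡ-< (k * m) (m%n<n L m))
  count≤k : count X L ≤ k
  count≤k = ≤-pred (≤-<-trans (count-mono X (<⇒≤ L<[1+k]·m)) (blocks (suc k) (m≤n⇒m≤1+n N≤k)))
  k·q<L : k * q < L
  k·q<L with k * q in eq
  ... | zero  = <-≤-trans z<s N·m<L
  ... | suc r = <-≤-trans (m<m+n (suc r) z<s)
                  (subst (_≤ L) (trans (*-distribˡ-+ k q q) (cong₂ _+_ eq eq)) (m/n*n≤m L m))

ρ-below : ∀ X n p d .(cop : Coprime (suc p) (suc d)) → count X (suc n) * suc d < suc p * suc n →
          ρ X (suc n) ℚ.< mkℚ (ℤ.+ suc p) d cop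
ρ-below X n p d cop c·q<p·L = ℚ.toℚᵘ-cancel-<
  (ℚᵘ.<-respˡ-≃ (ℚᵘ.≃-sym (ℚ.toℚᵘ-fromℚᵘ (ℚᵘ.mkℚᵘ (ℤ.+ count X (suc n)) n)))
    (ℚᵘ.*<* (subst₂ ℤ._<_ (ℤ.pos-* (count X (suc n)) (suc d)) (ℤ.pos-* (suc p) (suc n))
                         (ℤ.+<+ c·q<p·L))))

sparse⇒LimZero : ∀ X → (∀ d → ∃ λ N → ∀ L → N ≤ L → count X L * suc d < L) → LimZero (ρ X)
sparse⇒LimZero X sparse (mkℚ (ℤ.+ zero) d cop) pos with ℚ.positive pos
... | ()
sparse⇒LimZero X sparse (mkℚ ℤ.-[1+ _ ] d cop) pos with ℚ.positive pos
... | ()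
sparse⇒LimZero X sparse (mkℚ (ℤ.+ suc p) d cop) pos =
  let N , eventually = sparse d in
  suc N , λ { (suc n) N<1+n → ρ-below X n p d cop
                (<-≤-trans (eventually (suc n) (<⇒≤ N<1+n)) (m≤n*m (suc n) (suc p))) }

-- For a dense immune S and a computable permutation π, π(S) has fewer than
-- j points in [0,j·m) for all large j: its preimage lies in [0,B(j·m)), which
-- holds fewer than j points of S since p_S(j) > B(j·m) eventually.
image-sparse-blocks : ∀ S → DenseImmune S → (π : ℕ ↔ ℕ) → Computable (Inverse.to π) →
                      ∀ m → ∃ λ N → ∀ j → N ≤ j → count (image π S) (j * m) < j
image-sparse-blocks S (_ , immune) π π-computable m =
  let N , p>f = immune f f-computable in
  N , λ j N≤j → ≤-<-trans
        (count-injection from from-injective (B (j * m)) (j * m) S (bound-strict from (j * m)))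
        (principal-above⇒count-below S j (B (j * m)) (p>f j N≤j))
  where
  open Inverse π
  B : ℕ → ℕ
  B = bound from
  f : ℕ → ℕ
  f = suc ∘ B ∘ (_* m)
  f-computable : Computable f
  f-computable = computable-∘ computable-suc
    (computable-∘ (bound-computable (inverse-computable π π-computable)) (computable-*const m))
  from-injective : ∀ {x y} → from x ≡ from y → x ≡ y
  from-injective = Injection.injective (↔⇒↣ (↔-sym π))

mainTheorem17 : (S : ℕ → Bool) → DenseImmune S → IntrinsicDensityZero S
mainTheorem17 S S-dense-immune π π-computable = sparse⇒LimZero (image π S) λ d →
  let N , blocks = image-sparse-blocks S S-dense-immune π π-computable (suc d + suc d)
  in suc (N * (suc d + suc d)) , sparse-blocks⇒sparse (image π S) d N blocks
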